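{- Let $r\in\mathbb{Q}\cap(0,1)$ with $r\neq 1/2$, and write $r=[0,n_1,n_2,\dots,n_k]$ with $k\ge 1$, all $n_i\ge 1$ and $n_k\ge 2$. Then the Lebesgue transition probability of $r$ is $$\pi_\lambda(r)=1-[0,\,n_k-1,\,n_{k-1},\,\dots,\,n_2,\,n_1].$$
   Context: Continued fraction notation: $[0,a_1,\dots,a_m]=\cfrac{1}{a_1+\cfrac{1}{\ddots+\cfrac{1}{a_m}}}$, with $[0]=0$. Every $r\in\mathbb{Q}\cap(0,1)$ has a unique expansion $r=[0,n_1,\dots,n_k]$ with positive integers $n_i$ and $n_k\ge 2$. The Farey tree $\mathcal F$ has vertex set $\mathbb{Q}\cap(0,1)$ and root $1/2$. For a vertex $r=[0,n_1,\dots,n_k]\neq 1/2$ (with $n_k\ge2$), its parent is $[0,n_1,\dots,n_{k-1},n_k-1]$, where a trailing entry $1$ is absorbed via $[0,\dots,a,1]=[0,\dots,a+1]$. Equivalently, the two children of $[0,n_1,\dots,n_k]$ are $[0,n_1,\dots,n_k+1]$ and $[0,n_1,\dots,n_k-1,2]$. The Farey interval of a vertex $r=[0,n_1,\dots,n_k]$ (with $n_k\ge2$) is the closed interval $I(r)$ with endpoints $[0,n_1,\dots,n_{k-1}]$ and $[0,n_1,\dots,n_{k-1},n_k-1]$. In particular, $I(1/2)=[0,1]$ and $I(1/n)=[0,1/(n-1)]$. Write $|I|$ for the length of an interval. The Lebesgue transition function $\pi_\lambda:\mathbb{Q}\cap(0,1)\to[0,1]$ is defined by $\pi_\lambda(1/2)=1$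 and, for $r\neq 1/2$, $\pi_\lambda(r)=|I(r)|/|I(\mathrm{parent}(r))|$. This is the probability that a non-backtracking random walker, starting at the root and inducing Lebesgue measure on $[0,1]$ via the Farey intervals, steps from the parent of $r$ to $r$. -}

module Defs where

open import Data.Nat as ℕ using (ℕ; zero; suc; _∸_)
open import Data.Integer using (+_)
open import Data.Rational using (ℚ; 0ℚ; 1ℚ; _+_; _-_; _*_; ∣_∣; 1/_; ≢-nonZero)
open import Data.Rational.Properties using (_≟_)
open import Data.List using (List; []; _∷_; _∷ʳ_; reverse)
open import Data.Product using (_×_; _,_)
open import Relation.Nullary using (yes; no)

ℕtoℚ : ℕ → ℚ
ℕtoℚ n = Data.Rational._/_ (+ n) 1

-- total reciprocal (junk value 0 at 0; never used at 0 for valid inputs)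
inv : ℚ → ℚ
inv p with p ≟ 0ℚ
... | yes _ = 0ℚ
... | no p≢0 = 1/_ p {{≢-nonZero p≢0}}

_⊘_ : ℚ → ℚ → ℚ
p ⊘ q = p * inv q

-- continued fraction [0, a₁, …, aₘ] ; cf [] = [0] = 0
cf : List ℕ → ℚ
cf [] = 0ℚ
cf (a ∷ as) = inv (ℕtoℚ a + cf as)

-- An expansion [0, n₁, …, nₖ] is represented by the pair (n₁ … nₖ₋₁ , nₖ);
-- it denotes the rational  cf (ns ∷ʳ nₖ).

-- Length of the Farey interval I([0,ns,m]), whose endpoints are
-- [0,ns] and [0,ns,m-1].
fareyLength : List ℕ → ℕ → ℚ
fareyLength ns m = ∣ cf ns - cf (ns ∷ʳ (m ∸ 1)) ∣

private
  parentRev : List ℕ → ℕ → List ℕ × ℕ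
  -- argument: reversed prefix (nₖ₋₁ … n₁) and nₖ
  parentRev rs (suc (suc (suc j))) = reverse rs , suc (suc j)
  parentRev [] m = [] , m                       -- root 1/2 : no parent (junk)
  parentRev (a ∷ rs) m = reverse rs , suc a     -- nₖ = 2 : [..,a,1] = [..,a+1]

-- parent in the Farey tree of [0, ns, m] (with m ≥ 2), in normalised form:
-- [0,n₁,…,nₖ₋₁,nₖ-1], with a trailing 1 absorbed.
parent : List ℕ → ℕ → List ℕ × ℕ
parent ns m = parentRev (reverse ns) m

πλ : List ℕ → ℕ → ℚ
πλ [] 2 = 1ℚ
πλ ns m with parent ns m
... | (ps , p) = fareyLength ns m ⊘ fareyLength ps p

{-# OPTIONS --safe #-}
module Submission where

-- Write the prefix backwards, rs = (nₖ₋₁, …, n₁), and let q = den rs, q′ = prevDen rs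
-- be the denominators of the last two convergents of [0,n₁,…,nₖ₋₁]. Appending x gives
-- denominator qₓ = x q + q′, and since consecutive convergents are unimodular the Farey
-- interval of [0,n₁,…,nₖ₋₁,x+1] has length 1/(q qₓ). The mirror formula
-- [0,c,nₖ₋₁,…,n₁] = q / q_c then does the rest. For nₖ ≥ 3 the parent is
-- [0,…,nₖ−1], so π_λ = q_{nₖ−2} / q_{nₖ−1} = 1 − q / q_{nₖ−1}. For nₖ = 2 the parent
-- is [0,…,nₖ₋₂,nₖ₋₁+1], whose interval has length 1/(q′ q), so
-- π_λ = q′ / (q + q′) = 1 − [0,1,nₖ₋₁,…,n₁].

open import Algebra.Properties.AbelianGroup using (⁻¹-anti-homo‿-)
open import Data.Empty using (⊥-elim)
open import Data.Integer as ℤ using (+_; +[1+_]; -[1+_])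
import Data.Integer.Properties as ℤ
open import Data.Integer.Tactic.RingSolver as ℤSolver using ()
open import Data.List using (List; []; _∷_; _∷ʳ_; reverse)
import Data.List.Properties as List
open import Data.List.Relation.Unary.All using (All; []; _∷_)
open import Data.List.Relation.Unary.All.Properties using (∷ʳ⁺)
open import Data.Nat using (ℕ; zero; suc; _+_; _*_; _≤_; _∸_; s≤s; z≤n)
import Data.Nat.Properties as ℕ
open import Data.Nat.Tactic.RingSolver using (solve-∀)
open import Data.Product using (_,_)
open import Data.Rational as ℚ using (ℚ; 0ℚ; 1ℚ; mkℚ; toℚᵘ; _-_; ∣_∣)
import Data.Rational.Properties as ℚ
open import Data.Rational.Unnormalised as ℚᵘ using (ℚᵘ; mkℚᵘ; _≃_; *≡*)
import Data.Rational.Unnormalised.Properties as ℚᵘ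
open import Relation.Binary.PropositionalEquality
open import Relation.Nullary using (yes; no)

open import Defs

1≤m*n+o : ∀ {m n} o → 1 ≤ m → 1 ≤ n → 1 ≤ m * n + o
1≤m*n+o o 1≤m 1≤n = ℕ.≤-trans (ℕ.*-mono-≤ 1≤m 1≤n) (ℕ.m≤m+n _ o)

1≤m*n⇒1≤n : ∀ m {n} → 1 ≤ m * n → 1 ≤ n
1≤m*n⇒1≤n m {zero}  1≤m*0 with () ← subst (1 ≤_) (ℕ.*-zeroʳ m) 1≤m*0
1≤m*n⇒1≤n m {suc n} _     = s≤s z≤n

All-reverse : ∀ {A : Set} {P : A → Set} {xs} → All P xs → All P (reverse xs)
All-reverse []                        = []
All-reverse {xs = x ∷ xs} (px ∷ pxs) rewrite List.unfold-reverse x xs = ∷ʳ⁺ (All-reverse pxs) px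

∣p-q∣≡∣q-p∣ : ∀ p q → ∣ p - q ∣ ≡ ∣ q - p ∣
∣p-q∣≡∣q-p∣ p q = begin
  ∣ p - q ∣        ≡⟨ cong ∣_∣ (⁻¹-anti-homo‿- ℚ.+-0-abelianGroup q p) ⟨
  ∣ ℚ.- (q - p) ∣  ≡⟨ ℚ.∣-p∣≡∣p∣ (q - p) ⟩
  ∣ q - p ∣        ∎
  where open ≡-Reasoning

-- Every rational below is evaluated as a fraction of naturals; the record carries the
-- positivity of the denominator, without which d ∸ 1 would silently turn n/0 into n/1.
infix 4 _≈_/_

_/ᵘ_ : ℕ → ℕ → ℚᵘ
n /ᵘ d = mkℚᵘ (+ n) (d ∸ 1)

record _≈_/_ (p : ℚ) (n d : ℕ) : Set where
  constructor frac
  field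
    den≥1 : 1 ≤ d
    toℚᵘ≃ : toℚᵘ p ≃ n /ᵘ d

≈-unique : ∀ {p q n d} → p ≈ n / d → q ≈ n / d → p ≡ q
≈-unique (frac _ p≃) (frac _ q≃) = ℚ.toℚᵘ-injective (ℚᵘ.≃-trans p≃ (ℚᵘ.≃-sym q≃))

≈-cong : ∀ {p n d n′ d′} → p ≈ n / d → n ≡ n′ → d ≡ d′ → p ≈ n′ / d′
≈-cong p≈ refl refl = p≈

≈-rescale : ∀ {p n d n′ d′} → p ≈ n / d → 1 ≤ d′ → n * d′ ≡ n′ * d → p ≈ n′ / d′
≈-rescale {n = n} {suc d} {n′} {suc d′} (frac _ p≃) 1≤d′ nd′≡n′d = frac 1≤d′ (ℚᵘ.≃-trans p≃ (*≡* (begin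
  + n ℤ.* + suc d′   ≡⟨ ℤ.pos-* n (suc d′) ⟨
  + (n * suc d′)     ≡⟨ cong +_ nd′≡n′d ⟩
  + (n′ * suc d)     ≡⟨ ℤ.pos-* n′ (suc d) ⟩
  + n′ ℤ.* + suc d   ∎)))
  where open ≡-Reasoning

≈-ℕ : ∀ n → ℕtoℚ n ≈ n / 1
≈-ℕ n = frac (s≤s z≤n) (ℚ.toℚᵘ-fromℚᵘ (mkℚᵘ (+ n) 0))

≈-+ : ∀ {p q a b c d} → p ≈ a / b → q ≈ c / d → p ℚ.+ q ≈ (a * d + c * b) / (b * d)
≈-+ {p} {q} {a} {suc b} {c} {suc d} (frac 1≤b p≃) (frac 1≤d q≃) =
  frac (ℕ.*-mono-≤ 1≤b 1≤d)
    (ℚᵘ.≃-trans (ℚ.toℚᵘ-homo-+ p q) (ℚᵘ.≃-trans (ℚᵘ.+-cong p≃ q≃) (*≡* (cong (ℤ._* + (suc b * suc d))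
      (sym (trans (ℤ.pos-+ (a * suc d) (c * suc b)) (cong₂ ℤ._+_ (ℤ.pos-* a (suc d)) (ℤ.pos-* c (suc b)))))))))

≈-- : ∀ {p q a b c d e} → p ≈ a / b → q ≈ c / d → a * d ≡ c * b + e → p - q ≈ e / (b * d)
≈-- {p} {q} {a} {suc b} {c} {suc d} {e} (frac 1≤b p≃) (frac 1≤d q≃) ad≡cb+e =
  frac (ℕ.*-mono-≤ 1≤b 1≤d)
    (ℚᵘ.≃-trans (ℚ.toℚᵘ-homo-+ p (ℚ.- q)) (ℚᵘ.≃-trans (ℚᵘ.+-cong p≃ (ℚᵘ.≃-trans (ℚ.toℚᵘ-homo‿- q) (ℚᵘ.-‿cong q≃)))
      (*≡* (cong (ℤ._* + (suc b * suc d)) numerator))))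
  where
  open ≡-Reasoning
  i+j-i≡j : ∀ i j → i ℤ.+ j ℤ.- i ≡ j
  i+j-i≡j = ℤSolver.solve-∀
  numerator : + a ℤ.* + suc d ℤ.+ ℤ.- (+ c) ℤ.* + suc b ≡ + e
  numerator = begin
    + a ℤ.* + suc d ℤ.+ ℤ.- (+ c) ℤ.* + suc b  ≡⟨ cong (ℤ._+_ (+ a ℤ.* + suc d)) (ℤ.neg-distribˡ-* (+ c) (+ suc b)) ⟨
    + a ℤ.* + suc d ℤ.- + c ℤ.* + suc b        ≡⟨ cong₂ ℤ._-_ (ℤ.pos-* a (suc d)) (ℤ.pos-* c (suc b)) ⟨
    + (a * suc d) ℤ.- + (c * suc b)            ≡⟨ cong (λ x → + x ℤ.- + (c * suc b)) ad≡cb+e ⟩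
    + (c * suc b + e) ℤ.- + (c * suc b)        ≡⟨ cong (ℤ._- + (c * suc b)) (ℤ.pos-+ (c * suc b) e) ⟩
    + (c * suc b) ℤ.+ + e ℤ.- + (c * suc b)    ≡⟨ i+j-i≡j (+ (c * suc b)) (+ e) ⟩
    + e                                        ∎

≈-* : ∀ {p q a b c d} → p ≈ a / b → q ≈ c / d → p ℚ.* q ≈ (a * c) / (b * d)
≈-* {p} {q} {a} {suc b} {c} {suc d} (frac 1≤b p≃) (frac 1≤d q≃) =
  frac (ℕ.*-mono-≤ 1≤b 1≤d)
    (ℚᵘ.≃-trans (ℚ.toℚᵘ-homo-* p q) (ℚᵘ.≃-trans (ℚᵘ.*-cong p≃ q≃)
      (*≡* (cong (ℤ._* + (suc b * suc d)) (sym (ℤ.pos-* a c))))))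

≈-inv : ∀ {p n d} → 1 ≤ n → p ≈ n / d → inv p ≈ d / n
≈-inv {p} {suc n} {suc d} 1≤n (frac 1≤d p≃) with p ℚ.≟ 0ℚ
... | yes refl with p≃
...   | *≡* ()
≈-inv {mkℚ +[1+ k ] k′ _} {suc n} {suc d} 1≤n (frac 1≤d (*≡* eq)) | no _ =
  frac 1≤n (*≡* (trans (ℤ.*-comm +[1+ k′ ] (+ suc n)) (trans (sym eq) (ℤ.*-comm +[1+ k ] (+ suc d)))))
≈-inv {mkℚ (+ zero) _ _} {suc n} {suc d} 1≤n (frac 1≤d (*≡* ())) | no _
≈-inv {mkℚ -[1+ _ ] _ _} {suc n} {suc d} 1≤n (frac 1≤d (*≡* ())) | no _

≈-∣∣ : ∀ {p n d} → p ≈ n / d → ∣ p ∣ ≈ n / d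
≈-∣∣ {p} (frac 1≤d p≃) = frac 1≤d (ℚᵘ.≃-trans (ℚ.toℚᵘ-homo-∣-∣ p) (ℚᵘ.∣-∣-cong p≃))

≈-ℕ+ : ∀ a {p n d} → p ≈ n / d → ℕtoℚ a ℚ.+ p ≈ (a * d + n) / d
≈-ℕ+ a {n = n} {d} p≈@(frac 1≤d _) = ≈-rescale (≈-+ (≈-ℕ a) p≈) 1≤d (rearrange a d n)
  where
  rearrange : ∀ a d n → (a * d + n * 1) * d ≡ (a * d + n) * (1 * d)
  rearrange = solve-∀

≈-⊘-cancel : ∀ {p q b c d} → p ≈ 1 / (b * c) → q ≈ 1 / (b * d) → p ⊘ q ≈ d / c
≈-⊘-cancel {b = b} {c} {d} p≈@(frac 1≤bc _) q≈ =
  ≈-rescale (≈-* p≈ (≈-inv (s≤s z≤n) q≈)) (1≤m*n⇒1≤n b 1≤bc) (rearrange b c d)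
  where
  rearrange : ∀ b c d → 1 * (b * d) * c ≡ d * (b * c * 1)
  rearrange = solve-∀

data Unimodular (a b c d : ℕ) : Set where
  det≡-1 : a * d + 1 ≡ b * c → Unimodular a b c d
  det≡1  : b * c + 1 ≡ a * d → Unimodular a b c d

Unimodular-swap : ∀ {a b c d} → Unimodular a b c d → Unimodular b a d c
Unimodular-swap (det≡-1 ad+1≡bc) = det≡1 ad+1≡bc
Unimodular-swap (det≡1 bc+1≡ad)  = det≡-1 bc+1≡ad

Unimodular-shear : ∀ x {a b c d} → Unimodular a b c d → Unimodular a (x * a + b) c (x * c + d)
Unimodular-shear x {a} {b} {c} {d} (det≡-1 ad+1≡bc) = det≡-1 (begin
  a * (x * c + d) + 1      ≡⟨ expand x a c d ⟩
  x * a * c + (a * d + 1)  ≡⟨ cong (_+_ (x * a * c)) ad+1≡bc ⟩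
  x * a * c + b * c        ≡⟨ ℕ.*-distribʳ-+ c (x * a) b ⟨
  (x * a + b) * c          ∎)
  where
  open ≡-Reasoning
  expand : ∀ x a c d → a * (x * c + d) + 1 ≡ x * a * c + (a * d + 1)
  expand = solve-∀
Unimodular-shear x {a} {b} {c} {d} (det≡1 bc+1≡ad) = det≡1 (begin
  (x * a + b) * c + 1      ≡⟨ expand x a b c ⟩
  x * a * c + (b * c + 1)  ≡⟨ cong (_+_ (x * a * c)) bc+1≡ad ⟩
  x * a * c + a * d        ≡⟨ collect x a c d ⟩
  a * (x * c + d)          ∎)
  where
  open ≡-Reasoning
  expand : ∀ x a b c → (x * a + b) * c + 1 ≡ x * a * c + (b * c + 1)
  expand = solve-∀
  collect : ∀ x a c d → x * a * c + a * d ≡ a * (x * c + d)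
  collect = solve-∀

≈-∣-∣ : ∀ {p q a b c d} → p ≈ a / b → q ≈ c / d → Unimodular a c b d → ∣ p - q ∣ ≈ 1 / (b * d)
≈-∣-∣ p≈ q≈ (det≡1 cb+1≡ad) = ≈-∣∣ (≈-- p≈ q≈ (sym cb+1≡ad))
≈-∣-∣ {p} {q} {b = b} {d = d} p≈ q≈ (det≡-1 ad+1≡cb) =
  subst (_≈ 1 / (b * d)) (∣p-q∣≡∣q-p∣ q p)
    (≈-cong (≈-∣∣ (≈-- q≈ p≈ (sym ad+1≡cb))) refl (ℕ.*-comm d b))

-- Continuants of a list read backwards: for rs = (aⱼ, …, a₁) the convergents of
-- [0,a₁,…,aⱼ] are num rs / den rs and prevNum rs / prevDen rs, so a ∷ rs appends a.
num den prevNum prevDen : List ℕ → ℕ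
num []            = 0
num (a ∷ rs)      = a * num rs + prevNum rs
den []            = 1
den (a ∷ rs)      = a * den rs + prevDen rs
prevNum []        = 1
prevNum (_ ∷ rs)  = num rs
prevDen []        = 0
prevDen (_ ∷ rs)  = den rs

den-pos : ∀ {rs} → All (1 ≤_) rs → 1 ≤ den rs
den-pos []           = s≤s z≤n
den-pos (1≤a ∷ 1≤rs) = 1≤m*n+o _ 1≤a (den-pos 1≤rs)

convergents-unimodular : ∀ rs → Unimodular (num rs) (prevNum rs) (den rs) (prevDen rs)
convergents-unimodular []       = det≡-1 refl
convergents-unimodular (a ∷ rs) = Unimodular-swap (Unimodular-shear a (convergents-unimodular rs))

cfMap : List ℕ → ℚ → ℚ
cfMap []       t = t
cfMap (a ∷ as) t = inv (ℕtoℚ a ℚ.+ cfMap as t)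

cf≡cfMap-0 : ∀ as → cf as ≡ cfMap as 0ℚ
cf≡cfMap-0 []       = refl
cf≡cfMap-0 (a ∷ as) = cong (λ t → inv (ℕtoℚ a ℚ.+ t)) (cf≡cfMap-0 as)

cfMap-∷ʳ : ∀ as a t → cfMap (as ∷ʳ a) t ≡ cfMap as (inv (ℕtoℚ a ℚ.+ t))
cfMap-∷ʳ []       a t = refl
cfMap-∷ʳ (b ∷ as) a t = cong (λ s → inv (ℕtoℚ b ℚ.+ s)) (cfMap-∷ʳ as a t)

cfMap-reverse≈ : ∀ {rs t u v} → All (1 ≤_) rs → t ≈ u / v →
  cfMap (reverse rs) t ≈ (num rs * v + prevNum rs * u) / (den rs * v + prevDen rs * u)
cfMap-reverse≈ {[]} {u = u} {v} [] t≈ = ≈-cong t≈ (padˡ u v) (padʳ v u)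
  where
  padˡ : ∀ x y → x ≡ 0 * y + 1 * x
  padˡ = solve-∀
  padʳ : ∀ x y → x ≡ 1 * x + 0 * y
  padʳ = solve-∀
cfMap-reverse≈ {a ∷ rs} {t} {u} {v} (1≤a ∷ 1≤rs) t≈@(frac 1≤v _) =
  subst (_≈ _ / _) (sym (trans (cong (λ xs → cfMap xs t) (List.unfold-reverse a rs)) (cfMap-∷ʳ (reverse rs) a t)))
    (≈-cong (cfMap-reverse≈ 1≤rs (≈-inv (1≤m*n+o u 1≤a 1≤v) (≈-ℕ+ a t≈)))
      (regroup a u v (num rs) (prevNum rs)) (regroup a u v (den rs) (prevDen rs)))
  where
  regroup : ∀ a u v x y → x * (a * v + u) + y * v ≡ (a * x + y) * v + x * u
  regroup = solve-∀

cf-reverse≈ : ∀ {rs} → All (1 ≤_) rs → cf (reverse rs) ≈ num rs / den rs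
cf-reverse≈ {rs} 1≤rs = subst (_≈ num rs / den rs) (sym (cf≡cfMap-0 (reverse rs)))
  (≈-cong (cfMap-reverse≈ 1≤rs (≈-ℕ 0)) (drop-0 (num rs) (prevNum rs)) (drop-0 (den rs) (prevDen rs)))
  where
  drop-0 : ∀ x y → x * 1 + y * 0 ≡ x
  drop-0 = solve-∀

cf≈prevDen/den : ∀ {rs} → All (1 ≤_) rs → cf rs ≈ prevDen rs / den rs
cf≈prevDen/den []                    = ≈-ℕ 0
cf≈prevDen/den {a ∷ _} (1≤a ∷ 1≤rs) = ≈-inv (den-pos (1≤a ∷ 1≤rs)) (≈-ℕ+ a (cf≈prevDen/den 1≤rs))

fareyLength-reverse≈ : ∀ {rs x} → All (1 ≤_) rs → 1 ≤ x →
  fareyLength (reverse rs) (suc x) ≈ 1 / (den rs * den (x ∷ rs))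
fareyLength-reverse≈ {rs} {x} 1≤rs 1≤x =
  subst (λ xs → ∣ cf (reverse rs) - cf xs ∣ ≈ 1 / (den rs * den (x ∷ rs))) (List.unfold-reverse x rs)
    (≈-∣-∣ (cf-reverse≈ 1≤rs) (cf-reverse≈ (1≤x ∷ 1≤rs)) (Unimodular-shear x (convergents-unimodular rs)))

1-cf≈ : ∀ c {rs} → All (1 ≤_) rs → 1 ≤ c → 1ℚ - cf (c ∷ rs) ≈ den ((c ∸ 1) ∷ rs) / den (c ∷ rs)
1-cf≈ (suc c) {rs} 1≤rs 1≤c =
  ≈-cong (≈-- (≈-ℕ 1) (cf≈prevDen/den (1≤c ∷ 1≤rs)) (split c (den rs) (prevDen rs)))
    refl (ℕ.*-identityˡ (den (suc c ∷ rs)))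
  where
  split : ∀ c q q′ → 1 * ((1 + c) * q + q′) ≡ q * 1 + (c * q + q′)
  split = solve-∀

parent-of-≥3 : ∀ ns j → parent ns (3 + j) ≡ (ns , 2 + j)
parent-of-≥3 ns j = cong (_, 2 + j) (List.reverse-involutive ns)

parent-reverse-∷-2 : ∀ a rs → parent (reverse (a ∷ rs)) 2 ≡ (reverse rs , suc a)
parent-reverse-∷-2 a rs rewrite List.reverse-involutive (a ∷ rs) = refl

πλ-parent : ∀ {ns m ps p} → (ns , m) ≢ ([] , 2) → parent ns m ≡ (ps , p) →
  πλ ns m ≡ fareyLength ns m ⊘ fareyLength ps p
πλ-parent {[]}    {0}                 _         refl = refl
πλ-parent {[]}    {1}                 _         refl = refl
πλ-parent {[]}    {2}                 ns,m≢root _    = ⊥-elim (ns,m≢root refl)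
πλ-parent {[]}    {suc (suc (suc _))} _         refl = refl
πλ-parent {_ ∷ _}                     _         refl = refl

πλ-reverse : ∀ {rs m} → All (1 ≤_) rs → 2 ≤ m → (reverse rs , m) ≢ ([] , 2) →
  πλ (reverse rs) m ≡ 1ℚ - cf ((m ∸ 1) ∷ rs)
πλ-reverse {m = 0} _ () _
πλ-reverse {m = 1} _ (s≤s ()) _
πλ-reverse {rs} {suc (suc (suc j))} 1≤rs _ rs,m≢root =
  trans (πλ-parent rs,m≢root (parent-of-≥3 (reverse rs) j))
        (≈-unique (≈-⊘-cancel {b = den rs} (fareyLength-reverse≈ 1≤rs (s≤s z≤n))
                                           (fareyLength-reverse≈ 1≤rs (s≤s z≤n)))
                  (1-cf≈ (2 + j) 1≤rs (s≤s z≤n)))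
πλ-reverse {[]}     {2} _            _ rs,m≢root = ⊥-elim (rs,m≢root refl)
πλ-reverse {a ∷ rs} {2} (1≤a ∷ 1≤rs) _ rs,m≢root =
  trans (πλ-parent rs,m≢root (parent-reverse-∷-2 a rs))
        (≈-unique (≈-⊘-cancel {b = den (a ∷ rs)} (fareyLength-reverse≈ (1≤a ∷ 1≤rs) (s≤s z≤n))
                    (≈-cong (fareyLength-reverse≈ 1≤rs 1≤a) refl (ℕ.*-comm (den rs) (den (a ∷ rs)))))
                  (1-cf≈ 1 (1≤a ∷ 1≤rs) (s≤s z≤n)))

mainTheorem1 : (ns : List ℕ) (nₖ : ℕ) → All (1 ≤_) ns → 2 ≤ nₖ →
    (ns , nₖ) ≢ ([] , 2) →
    πλ ns nₖ ≡ 1ℚ - cf ((nₖ ∸ 1) ∷ reverse ns)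
mainTheorem1 ns nₖ 1≤ns 2≤nₖ ns,nₖ≢root = begin
  πλ ns nₖ                          ≡⟨ cong (λ xs → πλ xs nₖ) (List.reverse-involutive ns) ⟨
  πλ (reverse (reverse ns)) nₖ      ≡⟨ πλ-reverse (All-reverse 1≤ns) 2≤nₖ rev-rev-ns,nₖ≢root ⟩
  1ℚ - cf ((nₖ ∸ 1) ∷ reverse ns)   ∎
  where
  open ≡-Reasoning
  rev-rev-ns,nₖ≢root : (reverse (reverse ns) , nₖ) ≢ ([] , 2)
  rev-rev-ns,nₖ≢root = subst (λ xs → (xs , nₖ) ≢ ([] , 2)) (sym (List.reverse-involutive ns)) ns,nₖ≢root
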